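{- Let $\mu\in\mathbb{Z}^r$ and let $\widehat{\alpha}=n\beta+sn^2\delta\in\widetilde{\Phi}^{(n)}_+$. Then $s_{\widehat{\alpha}}\mu\overset{n}{<}\mu$ if and only if $\langle\widehat{\alpha},\mu\rangle<0$.
   Context: Fix integers $r\ge2$, $n\ge1$. $\epsilon_i$ standard basis of $\mathbb{R}^r$, $(\cdot,\cdot)$ standard inner product, $\Phi=\{\epsilon_i-\epsilon_j:i\ne j\}$, $\Phi_+=\{\epsilon_i-\epsilon_j:i<j\}$, $Q=\mathbb{Z}\Phi$, $\delta$ a formal symbol; for $\beta\in\mathbb{R}^r$, $s\in\mathbb{R}$, $v\in\mathbb{R}^r$: $\langle\beta+s\delta,v\rangle=(\beta,v)+s$. Positive real affine roots: $\widetilde{\Phi}^{(n)}_+=\{n\beta+sn^2\delta:\beta\in\Phi_+,s\ge0\}\cup\{n\beta+sn^2\delta:\beta\in\Phi,s>0\}$. For $\widehat{\alpha}=n\beta+sn^2\delta$ the affine reflection $s_{\widehat{\alpha}}$ of $\mathbb{R}^r$ is $v\mapsto v-\langle\beta+sn\delta,v\rangle\beta$; it lies in $W^{(n)}_{\mathrm{Cox}}=nQ\rtimes S_r$ (acting on $\mathbb{R}^r$ by affine maps, $S_r$ permuting coordinates), a Coxeter group with simple reflections $s_i^{(n)}=(i\ i+1)$ ($1\le i\le r-1$) and $s_0^{(n)}(v_1,\dots,v_r)=(v_r+n,v_2,\dots,v_{r-1},v_1-n)$. $A^{(n)}=\{\lambda\in\mathbb{Z}^r:\lambda_1\ge\dots\ge\lambda_r,\lambda_1-\lambda_r\le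 n\}$. For $\mu\in\mathbb{Z}^r$ there are a unique $\lambda_\mu\in A^{(n)}$ and a unique minimal-length $w_\mu\in W^{(n)}_{\mathrm{Cox}}$ with $w_\mu\lambda_\mu=\mu$. Define $\nu\overset{n}{\le}\mu$ iff $\lambda_\nu=\lambda_\mu$ and $w_\nu\le w_\mu$ in the Bruhat order of $W^{(n)}_{\mathrm{Cox}}$; $\nu\overset{n}{<}\mu$ means $\nu\overset{n}{\le}\mu$ and $\nu\neq\mu$. -}

module Defs where

open import Data.Nat as ℕ using (ℕ; zero; suc; _∸_)
open import Data.Integer as ℤ using (ℤ; +_; _+_; _-_; _*_)
open import Data.Fin using (Fin; toℕ)
open import Data.List using (List; []; _∷_; _++_; [_]; reverse; length)
open import Data.Product using (Σ; ∃; _×_; _,_)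
open import Data.Sum using (_⊎_)
open import Data.Bool using (if_then_else_)
open import Relation.Nullary using (¬_; does)
open import Relation.Binary.PropositionalEquality using (_≡_; _≢_)
open import Relation.Binary.Construct.Closure.ReflexiveTransitive using (Star)

-- Vectors of ℤ^r, coordinates indexed 0..r-1 (coordinate p ↔ paper's index p+1).
Vecℤ : ℕ → Set
Vecℤ r = Fin r → ℤ

-- coordinate with a natural-number index (0 if out of range)
atℕ : ∀ {r} → Vecℤ r → ℕ → ℤ
atℕ {zero} v m = + 0
atℕ {suc r} v zero = v Fin.zero
  where import Data.Fin as Fin
atℕ {suc r} v (suc m) = atℕ (λ p → v (Fin.suc p)) m
  where import Data.Fin as Fin

_==_ : ℕ → ℕ → Data.Bool.Bool
m == k = does (m ℕ.≟ k)
  where import Data.Bool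

-- Simple reflections of W^(n)_Cox, indexed by g : Fin r.
-- toℕ g = 0      : s_0^(n)(v_1,...,v_r) = (v_r + n, v_2, ..., v_{r-1}, v_1 - n)
-- toℕ g = k + 1  : s_{k+1}^(n) = transposition (k+1 k+2) (paper's 1-based indices)
gen : (r n : ℕ) → Fin r → Vecℤ r → Vecℤ r
gen r n g v p with toℕ g
... | zero = if toℕ p == 0 then atℕ v (r ∸ 1) + + n
             else if toℕ p == (r ∸ 1) then atℕ v 0 - + n
             else v p
... | suc k = if toℕ p == k then atℕ v (suc k)
              else if toℕ p == suc k then atℕ v k
              else v p

-- Words in the simple reflections; the word g₁ g₂ … g_k acts as g₁ ∘ g₂ ∘ … ∘ g_k.
Word : ℕ → Set
Word r = List (Fin r)

act : (r n : ℕ) → Word r → Vecℤ r → Vecℤ r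
act r n [] v = v
act r n (g ∷ w) v = gen r n g (act r n w v)

-- Two words represent the same element of W^(n)_Cox (the action on ℤ^r is faithful).
Same : (r n : ℕ) → Word r → Word r → Set
Same r n u w = ∀ v p → act r n u v p ≡ act r n w v p

-- Reflections of the Coxeter group: conjugates x s_i x⁻¹ of simple reflections.
reflW : ∀ {r} → Word r → Fin r → Word r
reflW x i = x ++ [ i ] ++ reverse x

Shorter : (r n : ℕ) → Word r → Word r → Set
Shorter r n u w = ∃ λ u' → Same r n u' u × (∀ w' → Same r n w' w → length u' ℕ.< length w')

BruhatStep : (r n : ℕ) → Word r → Word r → Set
BruhatStep r n u w = Σ (Word r) λ x → Σ (Fin r) λ i →
  Same r n w (u ++ reflW x i) × Shorter r n u w

BruhatLe : (r n : ℕ) → Word r → Word r → Set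
BruhatLe r n u w = ∃ λ w' → Same r n w' w × Star (BruhatStep r n) u w'

InA : (r n : ℕ) → Vecℤ r → Set
InA r n l = (∀ p q → toℕ p ℕ.≤ toℕ q → l q ℤ.≤ l p) × (atℕ l 0 - atℕ l (r ∸ 1) ℤ.≤ + n)

-- a is a word of an element of minimal length among those w with w λ = μ
-- (equivalently: a is a reduced word for w_μ when λ = λ_μ)
MinRep : (r n : ℕ) → Vecℤ r → Vecℤ r → Word r → Set
MinRep r n l μ a = (∀ p → act r n a l p ≡ μ p) ×
  (∀ x → (∀ p → act r n x l p ≡ μ p) → length a ℕ.≤ length x)

LeN : (r n : ℕ) → Vecℤ r → Vecℤ r → Set
LeN r n ν μ = Σ (Vecℤ r) λ l → InA r n l × Σ (Word r) λ a → Σ (Word r) λ b →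
  MinRep r n l ν a × MinRep r n l μ b × BruhatLe r n a b

LtN : (r n : ℕ) → Vecℤ r → Vecℤ r → Set
LtN r n ν μ = LeN r n ν μ × ¬ (∀ p → ν p ≡ μ p)

root : ∀ {r} → Fin r → Fin r → Vecℤ r
root i j p = (if toℕ p == toℕ i then + 1 else + 0) - (if toℕ p == toℕ j then + 1 else + 0)

-- α̂ = nβ + s n² δ with β = ε_i - ε_j is in Φ̃^(n)_+
PosAffRoot : ∀ {r} → Fin r → Fin r → ℤ → Set
PosAffRoot i j s = i ≢ j × ((toℕ i ℕ.< toℕ j × + 0 ℤ.≤ s) ⊎ + 0 ℤ.< s)

pairing : ∀ {r} → ℕ → Fin r → Fin r → ℤ → Vecℤ r → ℤ
pairing n i j s μ = + n * (μ i - μ j) + s * (+ n * + n)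

affRefl : ∀ {r} → ℕ → Fin r → Fin r → ℤ → Vecℤ r → Vecℤ r
affRefl n i j s μ p = μ p - ((μ i - μ j) + s * + n) * root i j p

module Submission where

open import Defs
open import Data.Nat as ℕ using (ℕ; zero; suc; z≤n; s≤s; _≤_)
import Data.Nat.Properties as ℕP
open import Data.Integer as ℤ using (ℤ; +_; -_; _+_; _-_; _*_; +≤+; +<+; -[1+_]; _<_)
import Data.Integer.Properties as ℤP
open import Data.Fin as F using (Fin; toℕ; inject₁; fromℕ)
import Data.Fin.Properties as FP
open import Data.Bool using (true; false; if_then_else_)
open import Data.Empty using (⊥; ⊥-elim)
open import Data.Unit using (⊤; tt)
open import Data.Product using (Σ; ∃; _×_; _,_; proj₁; proj₂)
open import Data.Sum using (_⊎_; inj₁; inj₂)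
open import Data.List using (List; []; _∷_; _++_; [_]; reverse; length)
import Data.List.Properties as LP
open import Relation.Nullary using (¬_; Dec; yes; no; does)
open import Relation.Nullary.Decidable using (map′; _×-dec_)
import Relation.Unary as U
open import Relation.Binary.PropositionalEquality hiding ([_])
open import Relation.Binary.Construct.Closure.ReflexiveTransitive using (Star; ε; _◅_; _◅◅_)
open import Relation.Binary.Definitions using (tri<; tri≈; tri>)
open import Function.Bundles using (_⇔_; mk⇔)
open import Data.Integer.Tactic.RingSolver using (solve-∀)

-- A simple reflection g acts as  (g v)_p = v_{τ g p} + n · e g p,
-- where τ g is an involution of the coordinates and e g ∈ {0, ±1}^R.
module Generators (r' n : ℕ) where

  R : ℕ
  R = suc (suc r')

  V : Set
  V = Vecℤ R

  lastR : Fin R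
  lastR = fromℕ (suc r')

  toℕ-last : toℕ lastR ≡ suc r'
  toℕ-last = FP.toℕ-fromℕ (suc r')

  last≢zero : lastR ≢ F.zero
  last≢zero eq = ℕP.1+n≢0 (trans (sym toℕ-last) (cong toℕ eq))

  inject₁≢suc : ∀ (g : Fin (suc r')) → inject₁ g ≢ F.suc g
  inject₁≢suc g eq = ℕP.1+n≢n (sym (trans (sym (FP.toℕ-inject₁ g)) (cong toℕ eq)))

  atℕ-toℕ : ∀ {m} (v : Vecℤ m) (q : Fin m) → atℕ v (toℕ q) ≡ v q
  atℕ-toℕ {suc m} v F.zero = refl
  atℕ-toℕ {suc m} v (F.suc q) = atℕ-toℕ (λ p → v (F.suc p)) q

  atℕ-last : ∀ (v : V) → atℕ v (suc r') ≡ v lastR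
  atℕ-last v = trans (cong (atℕ v) (sym toℕ-last)) (atℕ-toℕ v lastR)

  ==-refl : ∀ m → (m == m) ≡ true
  ==-refl zero = refl
  ==-refl (suc m) = ==-refl m

  ==-false : ∀ {m k} → m ≢ k → (m == k) ≡ false
  ==-false {zero} {zero} ne = ⊥-elim (ne refl)
  ==-false {zero} {suc k} ne = refl
  ==-false {suc m} {zero} ne = refl
  ==-false {suc m} {suc k} ne = ==-false {m} {k} (λ q → ne (cong suc q))

  τ : Fin R → Fin R → Fin R
  τ F.zero p = if toℕ p == 0 then lastR else if toℕ p == suc r' then F.zero else p
  τ (F.suc g) p = if toℕ p == toℕ g then F.suc g else if toℕ p == suc (toℕ g) then inject₁ g else p

  -1ℤ : ℤ
  -1ℤ = - (+ 1)

  e : Fin R → Fin R → ℤ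
  e F.zero p = if toℕ p == 0 then + 1 else if toℕ p == suc r' then -1ℤ else + 0
  e (F.suc g) p = + 0

  plus0 : ∀ x → x ≡ x + + n * + 0
  plus0 x = sym (trans (cong (λ z → x + z) (ℤP.*-zeroʳ (+ n))) (ℤP.+-identityʳ x))

  gen-shape : ∀ g v p → gen R n g v p ≡ v (τ g p) + + n * e g p
  gen-shape F.zero v p with toℕ p == 0 | toℕ p == suc r'
  ... | true | _ = cong₂ _+_ (atℕ-last v) (sym (ℤP.*-identityʳ (+ n)))
  ... | false | true = lem (v F.zero) (+ n)
    where
    lem : ∀ x y → x - y ≡ x + y * -1ℤ
    lem = solve-∀
  ... | false | false = plus0 (v p)
  gen-shape (F.suc g) v p with toℕ p == toℕ g | toℕ p == suc (toℕ g)
  ... | true | _ = trans (atℕ-toℕ v (F.suc g)) (plus0 _)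
  ... | false | true = trans (trans (cong (atℕ v) (sym (FP.toℕ-inject₁ g))) (atℕ-toℕ v (inject₁ g))) (plus0 _)
  ... | false | false = plus0 _

  data View0 (p : Fin R) : Set where
    first : p ≡ F.zero → View0 p
    last  : p ≡ lastR → View0 p
    other : toℕ p ≢ 0 → toℕ p ≢ suc r' → View0 p

  view0 : ∀ p → View0 p
  view0 p with toℕ p ℕ.≟ 0
  ... | yes q = first (FP.toℕ-injective q)
  ... | no q with toℕ p ℕ.≟ suc r'
  ...   | yes q' = last (FP.toℕ-injective (trans q' (sym toℕ-last)))
  ...   | no q' = other q q'

  data ViewS (g : Fin (suc r')) (p : Fin R) : Set where
    left  : p ≡ inject₁ g → ViewS g p
    right : p ≡ F.suc g → ViewS g p
    other : toℕ p ≢ toℕ g → toℕ p ≢ suc (toℕ g) → ViewS g p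

  viewS : ∀ g p → ViewS g p
  viewS g p with toℕ p ℕ.≟ toℕ g
  ... | yes q = left (FP.toℕ-injective (trans q (sym (FP.toℕ-inject₁ g))))
  ... | no q with toℕ p ℕ.≟ suc (toℕ g)
  ...   | yes q' = right (FP.toℕ-injective q')
  ...   | no q' = other q q'

  τ0-last : τ F.zero lastR ≡ F.zero
  τ0-last rewrite FP.toℕ-fromℕ r' | ==-refl r' = refl

  τ0-other : ∀ {p} → toℕ p ≢ 0 → toℕ p ≢ suc r' → τ F.zero p ≡ p
  τ0-other h1 h2 rewrite ==-false h1 | ==-false h2 = refl

  e0-last : e F.zero lastR ≡ -1ℤ
  e0-last rewrite FP.toℕ-fromℕ r' | ==-refl r' = refl

  e0-other : ∀ {p} → toℕ p ≢ 0 → toℕ p ≢ suc r' → e F.zero p ≡ + 0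
  e0-other h1 h2 rewrite ==-false h1 | ==-false h2 = refl

  τS-left : ∀ g → τ (F.suc g) (inject₁ g) ≡ F.suc g
  τS-left g rewrite FP.toℕ-inject₁ g | ==-refl (toℕ g) = refl

  τS-right : ∀ g → τ (F.suc g) (F.suc g) ≡ inject₁ g
  τS-right g rewrite ==-false (ℕP.1+n≢n {toℕ g}) | ==-refl (toℕ g) = refl

  τS-other : ∀ {g p} → toℕ p ≢ toℕ g → toℕ p ≢ suc (toℕ g) → τ (F.suc g) p ≡ p
  τS-other h1 h2 rewrite ==-false h1 | ==-false h2 = refl

  τ-involutive : ∀ g p → τ g (τ g p) ≡ p
  τ-involutive F.zero p with view0 p
  ... | first refl = τ0-last
  ... | last refl rewrite τ0-last = refl
  ... | other h1 h2 rewrite τ0-other h1 h2 | τ0-other h1 h2 = refl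
  τ-involutive (F.suc g) p with viewS g p
  ... | left refl rewrite τS-left g = τS-right g
  ... | right refl rewrite τS-right g = τS-left g
  ... | other h1 h2 rewrite τS-other {g} {p} h1 h2 | τS-other {g} {p} h1 h2 = refl

  e-antisymmetric : ∀ g p → e g (τ g p) ≡ - e g p
  e-antisymmetric F.zero p with view0 p
  ... | first refl = e0-last
  ... | last refl rewrite τ0-last | e0-last = refl
  ... | other h1 h2 rewrite τ0-other h1 h2 | e0-other h1 h2 = refl
  e-antisymmetric (F.suc g) p = refl

  τ-injective : ∀ g {p q} → τ g p ≡ τ g q → p ≡ q
  τ-injective g {p} {q} eq = trans (sym (τ-involutive g p)) (trans (cong (τ g) eq) (τ-involutive g q))

  ==-τ : ∀ g p q → (toℕ (τ g p) == toℕ (τ g q)) ≡ (toℕ p == toℕ q)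
  ==-τ g p q with p F.≟ q
  ... | yes refl = trans (==-refl (toℕ (τ g p))) (sym (==-refl (toℕ p)))
  ... | no ne = trans (==-false (λ eq → ne (τ-injective g (FP.toℕ-injective eq))))
                      (sym (==-false (λ eq → ne (FP.toℕ-injective eq))))

  root-τ : ∀ g i j p → root (τ g i) (τ g j) (τ g p) ≡ root i j p
  root-τ g i j p rewrite ==-τ g p i | ==-τ g p j = refl

  root-at-i : ∀ {i j : Fin R} → i ≢ j → root i j i ≡ + 1
  root-at-i {i} {j} ne
    rewrite ==-refl (toℕ i) | ==-false {toℕ i} {toℕ j} (λ eq → ne (FP.toℕ-injective eq)) = refl

  root-at-j : ∀ {i j : Fin R} → i ≢ j → root i j j ≡ -1ℤ
  root-at-j {i} {j} ne
    rewrite ==-refl (toℕ j) | ==-false {toℕ j} {toℕ i} (λ eq → ne (FP.toℕ-injective (sym eq))) = refl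

  root-elsewhere : ∀ {i j p : Fin R} → p ≢ i → p ≢ j → root i j p ≡ + 0
  root-elsewhere {i} {j} {p} n1 n2
    rewrite ==-false {toℕ p} {toℕ i} (λ eq → n1 (FP.toℕ-injective eq))
          | ==-false {toℕ p} {toℕ j} (λ eq → n2 (FP.toℕ-injective eq)) = refl

module AffineRoots (r' n : ℕ) where

  open Generators r' n

  -- h_α(v) = (β, v) + sn, so that ⟨α̂, v⟩ = n · h_α(v) and s_α̂ v = v − h_α(v) β.
  height : Fin R → Fin R → ℤ → V → ℤ
  height i j s v = (v i - v j) + s * + n

  -- The level of the root g·α̂, whose coordinates are (τ g i, τ g j).
  level : Fin R → Fin R → Fin R → ℤ → ℤ
  level g i j s = s + (e g i - e g j)

  gen-cong : ∀ g {v w : V} → (∀ q → v q ≡ w q) → ∀ p → gen R n g v p ≡ gen R n g w p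
  gen-cong g {v} {w} eq p rewrite gen-shape g v p | gen-shape g w p | eq (τ g p) = refl

  gen-involutive : ∀ g v p → gen R n g (gen R n g v) p ≡ v p
  gen-involutive g v p
    rewrite gen-shape g (gen R n g v) p | gen-shape g v (τ g p) | τ-involutive g p | e-antisymmetric g p
    = lem (v p) (+ n) (e g p)
    where
    lem : ∀ a m x → (a + m * (- x)) + m * x ≡ a
    lem = solve-∀

  height-gen : ∀ g i j s v → height (τ g i) (τ g j) (level g i j s) v ≡ height i j s (gen R n g v)
  height-gen g i j s v rewrite gen-shape g v i | gen-shape g v j =
    lem (v (τ g i)) (v (τ g j)) s (e g i) (e g j) (+ n)
    where
    lem : ∀ a b s x y m → (a - b) + (s + (x - y)) * m ≡ ((a + m * x) - (b + m * y)) + s * m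
    lem = solve-∀

  gen-conjugates : ∀ g i j s w p →
    gen R n g (affRefl n (τ g i) (τ g j) (level g i j s) w) p ≡ affRefl n i j s (gen R n g w) p
  gen-conjugates g i j s w p
    rewrite gen-shape g (affRefl n (τ g i) (τ g j) (level g i j s) w) p
          | gen-shape g w p | root-τ g i j p | sym (height-gen g i j s w)
    = lem (w (τ g p)) (height (τ g i) (τ g j) (level g i j s) w) (root i j p) (+ n * e g p)
    where
    lem : ∀ a h r c → (a - h * r) + c ≡ (a + c) - h * r
    lem = solve-∀

  affRefl-cong : ∀ i j s {u u' : V} → (∀ q → u q ≡ u' q) → ∀ p → affRefl n i j s u p ≡ affRefl n i j s u' p
  affRefl-cong i j s {u} {u'} eq p rewrite eq i | eq j | eq p = refl

  height-cong : ∀ i j s {u u' : V} → (∀ q → u q ≡ u' q) → height i j s u ≡ height i j s u'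
  height-cong i j s {u} {u'} eq rewrite eq i | eq j = refl

  height-affRefl : ∀ i j s u → i ≢ j → height i j s (affRefl n i j s u) ≡ - height i j s u
  height-affRefl i j s u ne rewrite root-at-i {i} {j} ne | root-at-j {i} {j} ne = lem (u i) (u j) (s * + n)
    where
    lem : ∀ a b c → ((a - ((a - b) + c) * + 1) - (b - ((a - b) + c) * -1ℤ)) + c ≡ - ((a - b) + c)
    lem = solve-∀

  affRefl-involutive : ∀ i j s u p → i ≢ j → affRefl n i j s (affRefl n i j s u) p ≡ u p
  affRefl-involutive i j s u p ne rewrite height-affRefl i j s u ne = lem (u p) (height i j s u) (root i j p)
    where
    lem : ∀ a h r → (a - h * r) - (- h) * r ≡ a
    lem = solve-∀

  affRefl-fixes : ∀ i j s u p → height i j s u ≡ + 0 → affRefl n i j s u p ≡ u p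
  affRefl-fixes i j s u p h0 = trans (cong (λ z → u p - z * root i j p) h0) (lem (u p) (root i j p))
    where
    lem : ∀ a b → a - + 0 * b ≡ a
    lem = solve-∀

  affRefl-moves : ∀ i j s u → i ≢ j → (∀ p → affRefl n i j s u p ≡ u p) → height i j s u ≡ + 0
  affRefl-moves i j s u ne fixed = begin
    h                         ≡⟨ lem (u i) h ⟩
    u i - (u i - h * + 1)     ≡⟨ cong (λ z → u i - (u i - h * z)) (sym (root-at-i ne)) ⟩
    u i - affRefl n i j s u i ≡⟨ cong (λ z → u i - z) (fixed i) ⟩
    u i - u i                 ≡⟨ ℤP.+-inverseʳ (u i) ⟩
    + 0                       ∎
    where
    open ≡-Reasoning
    h = height i j s u
    lem : ∀ a h → h ≡ a - (a - h * + 1)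
    lem = solve-∀

  -- The simple root of generator g: α_0 = ε_r − ε_1 + δ, α_{k+1} = ε_{k+1} − ε_{k+2}.
  αi αj : Fin R → Fin R
  αi F.zero = lastR
  αi (F.suc g) = inject₁ g
  αj F.zero = F.zero
  αj (F.suc g) = F.suc g

  αs : Fin R → ℤ
  αs F.zero = + 1
  αs (F.suc g) = + 0

  αi≢αj : ∀ g → αi g ≢ αj g
  αi≢αj F.zero = last≢zero
  αi≢αj (F.suc g) = inject₁≢suc g

  simple-height : Fin R → V → ℤ
  simple-height g v = height (αi g) (αj g) (αs g) v

  gen-is-reflection : ∀ g u p → affRefl n (αi g) (αj g) (αs g) u p ≡ gen R n g u p
  gen-is-reflection F.zero u p with view0 p
  ... | first refl rewrite gen-shape F.zero u F.zero | root-at-j {lastR} {F.zero} last≢zero =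
    lem (u F.zero) (u lastR) (+ n)
    where
    lem : ∀ a b m → a - ((b - a) + + 1 * m) * -1ℤ ≡ b + m * + 1
    lem = solve-∀
  ... | last refl rewrite gen-shape F.zero u lastR | root-at-i {lastR} {F.zero} last≢zero | τ0-last | e0-last =
    lem (u F.zero) (u lastR) (+ n)
    where
    lem : ∀ a b m → b - ((b - a) + + 1 * m) * + 1 ≡ a + m * -1ℤ
    lem = solve-∀
  ... | other h1 h2 rewrite gen-shape F.zero u p | τ0-other h1 h2 | e0-other h1 h2
    | root-elsewhere {lastR} {F.zero} {p} (λ eq → h2 (trans (cong toℕ eq) toℕ-last)) (λ eq → h1 (cong toℕ eq)) =
    lem (u p) (u lastR - u F.zero + + 1 * + n) (+ n)
    where
    lem : ∀ a h m → a - h * + 0 ≡ a + m * + 0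
    lem = solve-∀
  gen-is-reflection (F.suc g) u p with viewS g p
  ... | left refl rewrite gen-shape (F.suc g) u (inject₁ g) | root-at-i (inject₁≢suc g) | τS-left g =
    lem (u (inject₁ g)) (u (F.suc g)) (+ n)
    where
    lem : ∀ a b m → a - ((a - b) + + 0 * m) * + 1 ≡ b + m * + 0
    lem = solve-∀
  ... | right refl rewrite gen-shape (F.suc g) u (F.suc g) | root-at-j (inject₁≢suc g) | τS-right g =
    lem (u (inject₁ g)) (u (F.suc g)) (+ n)
    where
    lem : ∀ a b m → b - ((a - b) + + 0 * m) * -1ℤ ≡ a + m * + 0
    lem = solve-∀
  ... | other h1 h2 rewrite gen-shape (F.suc g) u p | τS-other {g} {p} h1 h2
    | root-elsewhere {inject₁ g} {F.suc g} {p} (λ eq → h1 (trans (cong toℕ eq) (FP.toℕ-inject₁ g))) (λ eq → h2 (cong toℕ eq)) =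
    lem (u p) (u (inject₁ g) - u (F.suc g) + + 0 * + n) (+ n)
    where
    lem : ∀ a h m → a - h * + 0 ≡ a + m * + 0
    lem = solve-∀

  simple-height-gen : ∀ g u → simple-height g (gen R n g u) ≡ - simple-height g u
  simple-height-gen g u = trans (height-cong (αi g) (αj g) (αs g) (λ q → sym (gen-is-reflection g u q)))
                                (height-affRefl (αi g) (αj g) (αs g) u (αi≢αj g))

module PositiveRoots (r' n : ℕ) where

  open Generators r' n
  open AffineRoots r' n

  Ori : Fin R → Fin R → ℤ → Set
  Ori i j s = (toℕ i ℕ.< toℕ j × + 0 ℤ.≤ s) ⊎ + 0 ℤ.< s

  ori-nonneg : ∀ {i j s} → Ori i j s → + 0 ℤ.≤ s
  ori-nonneg (inj₁ (_ , h)) = h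
  ori-nonneg (inj₂ h) = ℤP.<⇒≤ h

  ori-level0 : ∀ {i j s} → Ori i j s → Ori i j (s + + 0)
  ori-level0 {i} {j} {s} = subst (Ori i j) (sym (ℤP.+-identityʳ s))

  nonneg+suc : ∀ s k → + 0 ℤ.≤ s → + 0 ℤ.< s + + suc k
  nonneg+suc s k h = ℤP.+-mono-≤-< h (+<+ (s≤s z≤n))

  pos-1 : ∀ s → + 0 ℤ.< s → + 0 ℤ.≤ s + -1ℤ
  pos-1 s h = ℤP.i≤j⇒0≤j-i (ℤP.i<j⇒suc[i]≤j h)

  pos-2 : ∀ s → + 0 ℤ.< s → s ≢ + 1 → + 0 ℤ.≤ s + -[1+ 1 ]
  pos-2 s h ne = ℤP.i≤j⇒0≤j-i (ℤP.i<j⇒suc[i]≤j (ℤP.≤∧≢⇒< (ℤP.i<j⇒suc[i]≤j h) (λ eq → ne (sym eq))))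

  pos-0 : ∀ {i j} s → + 0 ℤ.< s → Ori i j (s + + 0)
  pos-0 s h = inj₂ (subst (+ 0 ℤ.<_) (sym (ℤP.+-identityʳ s)) h)

  toℕ≤last : ∀ (p : Fin R) → toℕ p ℕ.≤ suc r'
  toℕ≤last p = ℕP.≤-pred (FP.toℕ<n p)

  IsSimpleRoot : Fin R → Fin R → Fin R → ℤ → Set
  IsSimpleRoot g i j s = i ≡ αi g × j ≡ αj g × s ≡ αs g

  ori-gen-zero : ∀ i j s → i ≢ j → Ori i j s →
    IsSimpleRoot F.zero i j s ⊎ Ori (τ F.zero i) (τ F.zero j) (level F.zero i j s)
  ori-gen-zero i j s ne o with view0 i | view0 j
  ... | first refl | first refl = ⊥-elim (ne refl)
  ... | first refl | last refl rewrite τ0-last | e0-last = inj₂ (inj₂ (nonneg+suc s 1 (ori-nonneg o)))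
  ... | first refl | other h1 h2 rewrite τ0-other h1 h2 | e0-other h1 h2 = inj₂ (inj₂ (nonneg+suc s 0 (ori-nonneg o)))
  ... | last refl | first refl rewrite τ0-last | e0-last with o
  ...   | inj₁ (lt , _) = ⊥-elim (ℕP.<⇒≱ lt z≤n)
  ...   | inj₂ sp with s ℤ.≟ + 1
  ...     | yes eq = inj₁ (refl , refl , eq)
  ...     | no neq = inj₂ (inj₁ (subst (0 ℕ.<_) (sym toℕ-last) (s≤s z≤n) , pos-2 s sp neq))
  ori-gen-zero i j s ne o | last refl | last refl = ⊥-elim (ne refl)
  ori-gen-zero i j s ne o | last refl | other h1 h2 rewrite τ0-last | e0-last | τ0-other h1 h2 | e0-other h1 h2 with o
  ...   | inj₁ (lt , _) = ⊥-elim (ℕP.<⇒≱ lt (subst (toℕ j ℕ.≤_) (sym toℕ-last) (toℕ≤last j)))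
  ...   | inj₂ sp = inj₂ (inj₁ (ℕP.n≢0⇒n>0 h1 , pos-1 s sp))
  ori-gen-zero i j s ne o | other h1 h2 | first refl rewrite τ0-other h1 h2 | e0-other h1 h2 with o
  ...   | inj₁ (lt , _) = ⊥-elim (ℕP.<⇒≱ lt z≤n)
  ...   | inj₂ sp = inj₂ (inj₁ (subst (toℕ i ℕ.<_) (sym toℕ-last) (ℕP.≤∧≢⇒< (toℕ≤last i) h2) , pos-1 s sp))
  ori-gen-zero i j s ne o | other h1 h2 | last refl rewrite τ0-other h1 h2 | e0-other h1 h2 | τ0-last | e0-last =
    inj₂ (inj₂ (nonneg+suc s 0 (ori-nonneg o)))
  ori-gen-zero i j s ne o | other h1 h2 | other h3 h4
    rewrite τ0-other h1 h2 | e0-other h1 h2 | τ0-other h3 h4 | e0-other h3 h4 = inj₂ (ori-level0 o)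

  ori-gen-suc : ∀ g i j s → i ≢ j → Ori i j s →
    IsSimpleRoot (F.suc g) i j s ⊎ Ori (τ (F.suc g) i) (τ (F.suc g) j) (level (F.suc g) i j s)
  ori-gen-suc g i j s ne o with viewS g i | viewS g j | o
  ... | left refl | left refl | _ = ⊥-elim (ne refl)
  ... | right refl | right refl | _ = ⊥-elim (ne refl)
  ... | left refl | right refl | inj₂ sp rewrite τS-left g | τS-right g = inj₂ (pos-0 s sp)
  ... | left refl | right refl | inj₁ (_ , nn) with s ℤ.≟ + 0
  ...   | yes eq = inj₁ (refl , refl , eq)
  ...   | no neq rewrite τS-left g | τS-right g = inj₂ (pos-0 s (ℤP.≤∧≢⇒< nn (λ eq → neq (sym eq))))
  ori-gen-suc g i j s ne o | left refl | other h1 h2 | inj₂ sp rewrite τS-left g | τS-other {g} {j} h1 h2 = inj₂ (pos-0 s sp)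
  ori-gen-suc g i j s ne o | left refl | other h1 h2 | inj₁ (lt , nn) rewrite τS-left g | τS-other {g} {j} h1 h2 =
    inj₂ (ori-level0 (inj₁ (ℕP.≤∧≢⇒< (subst (ℕ._< toℕ j) (FP.toℕ-inject₁ g) lt) (λ eq → h2 (sym eq)) , nn)))
  ori-gen-suc g i j s ne o | right refl | left refl | inj₂ sp rewrite τS-left g | τS-right g = inj₂ (pos-0 s sp)
  ori-gen-suc g i j s ne o | right refl | left refl | inj₁ (lt , nn) =
    ⊥-elim (ℕP.<-asym lt (subst (ℕ._< suc (toℕ g)) (sym (FP.toℕ-inject₁ g)) (ℕP.n<1+n (toℕ g))))
  ori-gen-suc g i j s ne o | right refl | other h1 h2 | inj₂ sp rewrite τS-right g | τS-other {g} {j} h1 h2 = inj₂ (pos-0 s sp)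
  ori-gen-suc g i j s ne o | right refl | other h1 h2 | inj₁ (lt , nn) rewrite τS-right g | τS-other {g} {j} h1 h2 =
    inj₂ (ori-level0 (inj₁ (subst (ℕ._< toℕ j) (sym (FP.toℕ-inject₁ g)) (ℕP.<-trans (ℕP.n<1+n (toℕ g)) lt) , nn)))
  ori-gen-suc g i j s ne o | other h1 h2 | left refl | inj₂ sp rewrite τS-left g | τS-other {g} {i} h1 h2 = inj₂ (pos-0 s sp)
  ori-gen-suc g i j s ne o | other h1 h2 | left refl | inj₁ (lt , nn) rewrite τS-left g | τS-other {g} {i} h1 h2 =
    inj₂ (ori-level0 (inj₁ (ℕP.<-trans (subst (toℕ i ℕ.<_) (FP.toℕ-inject₁ g) lt) (ℕP.n<1+n (toℕ g)) , nn)))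
  ori-gen-suc g i j s ne o | other h1 h2 | right refl | inj₂ sp rewrite τS-right g | τS-other {g} {i} h1 h2 = inj₂ (pos-0 s sp)
  ori-gen-suc g i j s ne o | other h1 h2 | right refl | inj₁ (lt , nn) rewrite τS-right g | τS-other {g} {i} h1 h2 =
    inj₂ (ori-level0 (inj₁ (subst (toℕ i ℕ.<_) (sym (FP.toℕ-inject₁ g)) (ℕP.≤∧≢⇒< (ℕP.≤-pred lt) h1) , nn)))
  ori-gen-suc g i j s ne o | other h1 h2 | other h3 h4 | _ rewrite τS-other {g} {i} h1 h2 | τS-other {g} {j} h3 h4 =
    inj₂ (ori-level0 o)

  positive-gen : ∀ g i j s → PosAffRoot i j s →
    IsSimpleRoot g i j s ⊎ PosAffRoot (τ g i) (τ g j) (level g i j s)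
  positive-gen g i j s (ne , o) with ori-gen g
    where
    ori-gen : ∀ g → IsSimpleRoot g i j s ⊎ Ori (τ g i) (τ g j) (level g i j s)
    ori-gen F.zero = ori-gen-zero i j s ne o
    ori-gen (F.suc g) = ori-gen-suc g i j s ne o
  ... | inj₁ simple = inj₁ simple
  ... | inj₂ o' = inj₂ ((λ eq → ne (τ-injective g eq)) , o')

  simple-positive : ∀ g → PosAffRoot (αi g) (αj g) (αs g)
  simple-positive F.zero = last≢zero , inj₂ (+<+ (s≤s z≤n))
  simple-positive (F.suc g) =
    inject₁≢suc g , inj₁ (subst (ℕ._< suc (toℕ g)) (sym (FP.toℕ-inject₁ g)) (ℕP.n<1+n _) , +≤+ z≤n)

module Words (r' n : ℕ) where

  open Generators r' n
  open AffineRoots r' n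
  open PositiveRoots r' n

  act-cong : ∀ x {v w : V} → (∀ q → v q ≡ w q) → ∀ p → act R n x v p ≡ act R n x w p
  act-cong [] eq p = eq p
  act-cong (g ∷ x) eq p = gen-cong g (act-cong x eq) p

  act-++ : ∀ P S v p → act R n (P ++ S) v p ≡ act R n P (act R n S v) p
  act-++ [] S v p = refl
  act-++ (g ∷ P) S v p = gen-cong g (act-++ P S v) p

  act-reverse : ∀ S u p → act R n S (act R n (reverse S) u) p ≡ u p
  act-reverse [] u p = refl
  act-reverse (g ∷ S) u p = trans (gen-cong g inner p) (gen-involutive g u p)
    where
    inner : ∀ q → act R n S (act R n (reverse (g ∷ S)) u) q ≡ gen R n g u q
    inner q = trans (act-cong S (λ q' → trans (cong (λ z → act R n z u q') (LP.unfold-reverse g S))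
                                              (act-++ (reverse S) [ g ] u q')) q)
                    (act-reverse S (gen R n g u) q)

  length-insert : ∀ (P : Word R) g S → length (P ++ g ∷ S) ≡ suc (length (P ++ S))
  length-insert [] g S = refl
  length-insert (_ ∷ P) g S = cong suc (length-insert P g S)

  insert-is-reflection : ∀ P g S → Same R n (P ++ g ∷ S) ((P ++ S) ++ reflW (reverse S) g)
  insert-is-reflection P g S v p = sym (begin
    act R n ((P ++ S) ++ reflW (reverse S) g) v p
      ≡⟨ act-++ (P ++ S) _ v p ⟩
    act R n (P ++ S) (act R n (reflW (reverse S) g) v) p
      ≡⟨ act-++ P S _ p ⟩
    act R n P (act R n S (act R n (reflW (reverse S) g) v)) p
      ≡⟨ act-cong P cancel p ⟩
    act R n P (act R n (g ∷ S) v) p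
      ≡⟨ act-++ P (g ∷ S) v p ⟨
    act R n (P ++ g ∷ S) v p ∎)
    where
    open ≡-Reasoning
    cancel : ∀ q → act R n S (act R n (reflW (reverse S) g) v) q ≡ gen R n g (act R n S v) q
    cancel q = trans (act-cong S (act-++ (reverse S) (g ∷ reverse (reverse S)) v) q)
                 (trans (act-reverse S _ q)
                        (gen-cong g (λ q' → cong (λ z → act R n z v q') (LP.reverse-involutive S)) q))

  Dominant : V → Set
  Dominant l = ∀ i j s → PosAffRoot i j s → + 0 ℤ.≤ height i j s l

  exchange : ∀ l → Dominant l → ∀ a i j s → PosAffRoot i j s → height i j s (act R n a l) ℤ.< + 0 →
    Σ (Word R) λ P → Σ (Fin R) λ g → Σ (Word R) λ S → (a ≡ P ++ g ∷ S) ×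
      (∀ v p → act R n (P ++ S) v p ≡ affRefl n i j s (act R n a v) p)
  exchange l dom [] i j s pos neg = ⊥-elim (ℤP.<⇒≱ neg (dom i j s pos))
  exchange l dom (g ∷ a) i j s pos neg with positive-gen g i j s pos
  ... | inj₁ (refl , refl , refl) =
    [] , g , a , refl , λ v p → sym (trans (gen-is-reflection g _ p) (gen-involutive g _ p))
  ... | inj₂ pos' with exchange l dom a (τ g i) (τ g j) (level g i j s) pos'
                         (subst (ℤ._< + 0) (sym (height-gen g i j s (act R n a l))) neg)
  ...   | P , g' , S , eq , shortened = g ∷ P , g' , S , cong (g ∷_) eq ,
          λ v p → trans (gen-cong g (shortened v) p) (gen-conjugates g i j s (act R n a v) p)

  Ascending : V → Word R → Set
  Ascending l [] = ⊤
  Ascending l (g ∷ x) = Ascending l x × (+ 0 ℤ.< simple-height g (act R n x l))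

  ascending-minimal : ∀ l → Dominant l → ∀ x → Ascending l x →
    ∀ y → (∀ p → act R n y l p ≡ act R n x l p) → length x ℕ.≤ length y
  ascending-minimal l dom [] _ y eq = z≤n
  ascending-minimal l dom (g ∷ x) (asc , up) y eq
    with exchange l dom y (αi g) (αj g) (αs g) (simple-positive g) down
    where
    down : simple-height g (act R n y l) ℤ.< + 0
    down = subst (ℤ._< + 0)
             (sym (trans (height-cong (αi g) (αj g) (αs g) eq) (simple-height-gen g (act R n x l))))
             (ℤP.neg-mono-< up)
  ... | P , g' , S , refl , shortened =
    subst (suc (length x) ℕ.≤_) (sym (length-insert P g' S)) (s≤s (ascending-minimal l dom x asc (P ++ S) PS-sends))
    where
    PS-sends : ∀ p → act R n (P ++ S) l p ≡ act R n x l p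
    PS-sends p = trans (shortened l p)
      (trans (gen-is-reflection g _ p) (trans (gen-cong g eq p) (gen-involutive g (act R n x l) p)))

  ascending-or-descent : ∀ l x → Ascending l x ⊎ (Σ (Word R) λ P → Σ (Fin R) λ g → Σ (Word R) λ S →
    (x ≡ P ++ g ∷ S) × (simple-height g (act R n S l) ℤ.≤ + 0))
  ascending-or-descent l [] = inj₁ tt
  ascending-or-descent l (g ∷ x) with ascending-or-descent l x
  ... | inj₂ (P , g' , S , eq , h) = inj₂ (g ∷ P , g' , S , cong (g ∷_) eq , h)
  ... | inj₁ asc with + 0 ℤ.<? simple-height g (act R n x l)
  ...   | yes up = inj₁ (asc , up)
  ...   | no ¬up = inj₂ ([] , g , x , refl , ℤP.≮⇒≥ ¬up)

module Search where

  any-of-length? : ∀ {m} k (P : Word m → Set) → (∀ x → Dec (P x)) → Dec (∃ λ x → length x ≡ k × P x)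
  any-of-length? zero P P? with P? []
  ... | yes p = yes ([] , refl , p)
  ... | no ¬p = no λ { ([] , _ , p) → ¬p p ; (_ ∷ _ , () , _) }
  any-of-length? (suc k) P P? with FP.any? (λ g → any-of-length? k (λ x → P (g ∷ x)) (λ x → P? (g ∷ x)))
  ... | yes (g , x , eq , p) = yes (g ∷ x , cong suc eq , p)
  ... | no ¬p = no λ { ([] , () , _) ; (g ∷ x , eq , p) → ¬p (g , x , ℕP.suc-injective eq , p) }

  least : ∀ {P : ℕ → Set} → U.Decidable P → ∀ k → P k → ∃ λ m → P m × (∀ m' → P m' → m ≤ m')
  least {P} P? k pk = go k k ℕP.≤-refl pk
    where
    go : ∀ fuel k → k ≤ fuel → P k → ∃ λ m → P m × (∀ m' → P m' → m ≤ m')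
    go fuel k k≤fuel pk with ℕP.anyUpTo? P? k
    ... | no none = k , pk , λ m' pm' → ℕP.≮⇒≥ (λ m'<k → none (m' , m'<k , pm'))
    go zero k k≤0 pk | yes (m , m<k , pm) = ⊥-elim (ℕP.<⇒≱ (ℕP.<-≤-trans m<k k≤0) z≤n)
    go (suc fuel) k k≤fuel pk | yes (m , m<k , pm) = go fuel m (ℕP.≤-pred (ℕP.<-≤-trans m<k k≤fuel)) pm

  shortest : ∀ {m} (P : Word m → Set) → (∀ x → Dec (P x)) → ∀ c → P c →
    ∃ λ x → P x × (∀ y → P y → length x ≤ length y)
  shortest P P? c pc with least (λ k → any-of-length? k P P?) (length c) (c , refl , pc)
  ... | _ , (x , refl , px) , minimal = x , px , λ y py → minimal (length y) (y , refl , py)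

-- For n ≥ 1 the action of words on ℤ^r is faithful and computable: a word acts
-- as v ↦ v ∘ σ + n · shift, and (σ, shift) is determined by the action.
module Faithful (r' n : ℕ) (n≥1 : 1 ℕ.≤ n) where

  open Generators r' n

  σ : Word R → Fin R → Fin R
  σ [] p = p
  σ (g ∷ w) p = σ w (τ g p)

  shift : Word R → Fin R → ℤ
  shift [] p = + 0
  shift (g ∷ w) p = shift w (τ g p) + e g p

  act-shape : ∀ w v p → act R n w v p ≡ v (σ w p) + + n * shift w p
  act-shape [] v p = plus0 (v p)
  act-shape (g ∷ w) v p rewrite gen-shape g (act R n w v) p | act-shape w v (τ g p) =
    lem (v (σ w (τ g p))) (+ n) (shift w (τ g p)) (e g p)
    where
    lem : ∀ a m x y → (a + m * x) + m * y ≡ a + m * (x + y)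
    lem = solve-∀

  zero-vector : V
  zero-vector _ = + 0

  -- Comparing with the action on 0 isolates the permutation part.
  act-relative : ∀ w v p → act R n w v p - act R n w zero-vector p ≡ v (σ w p)
  act-relative w v p rewrite act-shape w v p | act-shape w zero-vector p = lem (v (σ w p)) (+ n * shift w p)
    where
    lem : ∀ a c → (a + c) - (+ 0 + c) ≡ a
    lem = solve-∀

  indicator : Fin R → V
  indicator q0 q = if does (q F.≟ q0) then + 1 else + 0

  indicator-one : ∀ q0 q → indicator q0 q ≡ + 1 → q ≡ q0
  indicator-one q0 q h with q F.≟ q0
  ... | yes eq = eq
  indicator-one q0 q () | no _

  indicator-self : ∀ q0 → indicator q0 q0 ≡ + 1
  indicator-self q0 with q0 F.≟ q0
  ... | yes _ = refl
  ... | no ne = ⊥-elim (ne refl)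

  same-σ : ∀ x y → Same R n x y → ∀ p → σ x p ≡ σ y p
  same-σ x y same p = sym (indicator-one q0 (σ y p) (begin
    indicator q0 (σ y p)                                     ≡⟨ act-relative y (indicator q0) p ⟨
    act R n y (indicator q0) p - act R n y zero-vector p     ≡⟨ cong₂ _-_ (same (indicator q0) p) (same zero-vector p) ⟨
    act R n x (indicator q0) p - act R n x zero-vector p     ≡⟨ act-relative x (indicator q0) p ⟩
    indicator q0 q0                                          ≡⟨ indicator-self q0 ⟩
    + 1                                                      ∎))
    where
    open ≡-Reasoning
    q0 = σ x p

  nonZero-n : ℤ.NonZero (+ n)
  nonZero-n = ℤ.≢-nonZero {+ n} (λ eq → ℕP.<⇒≢ n≥1 (sym (cong ℤ.∣_∣ eq)))

  same-shift : ∀ x y → Same R n x y → ∀ p → shift x p ≡ shift y p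
  same-shift x y same p = ℤP.*-cancelˡ-≡ (+ n) (shift x p) (shift y p) {{nonZero-n}} (begin
    + n * shift x p                            ≡⟨ ℤP.+-identityˡ _ ⟨
    + 0 + + n * shift x p                      ≡⟨ act-shape x zero-vector p ⟨
    act R n x zero-vector p                    ≡⟨ same zero-vector p ⟩
    act R n y zero-vector p                    ≡⟨ act-shape y zero-vector p ⟩
    + 0 + + n * shift y p                      ≡⟨ ℤP.+-identityˡ _ ⟩
    + n * shift y p                            ∎)
    where open ≡-Reasoning

  same? : ∀ x y → Dec (Same R n x y)
  same? x y = map′ to from (FP.all? (λ p → σ x p F.≟ σ y p) ×-dec FP.all? (λ p → shift x p ℤ.≟ shift y p))
    where
    to : (∀ p → σ x p ≡ σ y p) × (∀ p → shift x p ≡ shift y p) → Same R n x y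
    to (σ≡ , shift≡) v p rewrite act-shape x v p | act-shape y v p | σ≡ p | shift≡ p = refl
    from : Same R n x y → (∀ p → σ x p ≡ σ y p) × (∀ p → shift x p ≡ shift y p)
    from same = same-σ x y same , same-shift x y same

module Lowering (r' n : ℕ) (n≥1 : 1 ℕ.≤ n) (l : Vecℤ (suc (suc r')))
                (dom : Words.Dominant r' n l) where

  open Generators r' n
  open AffineRoots r' n
  open PositiveRoots r' n
  open Words r' n
  open Search
  open Faithful r' n n≥1

  Rep : V → Word R → Set
  Rep ν x = ∀ p → act R n x l p ≡ ν p

  rep? : ∀ ν x → Dec (Rep ν x)
  rep? ν x = FP.all? (λ p → act R n x l p ℤ.≟ ν p)

  Reduced : Word R → Set
  Reduced x = ∀ y → Same R n y x → length x ℕ.≤ length y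

  minRep-reduced : ∀ {ν a} → MinRep R n l ν a → Reduced a
  minRep-reduced (rep , minimal) y y≈a = minimal y (λ p → trans (y≈a l p) (rep p))

  reduce : ∀ c → ∃ λ x → Same R n x c × length x ℕ.≤ length c × Reduced x
  reduce c with shortest (λ x → Same R n x c) (λ x → same? x c) c (λ v p → refl)
  ... | x , x≈c , minimal =
    x , x≈c , minimal c (λ v p → refl) , λ y y≈x → minimal y (λ v p → trans (y≈x v p) (x≈c v p))

  step-resp : ∀ u u' w → Same R n u' u → BruhatStep R n u w → BruhatStep R n u' w
  step-resp u u' w u'≈u (x , i , w≈ut , (u0 , u0≈u , shorter)) =
    x , i ,
    (λ v p → trans (w≈ut v p) (trans (act-++ u _ v p) (trans (sym (u'≈u _ p)) (sym (act-++ u' _ v p))))) ,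
    (u0 , (λ v p → trans (u0≈u v p) (sym (u'≈u v p))) , shorter)

  delete-step : ∀ P g S → Reduced (P ++ g ∷ S) → BruhatStep R n (P ++ S) (P ++ g ∷ S)
  delete-step P g S red =
    reverse S , g , insert-is-reflection P g S ,
    ((P ++ S) , (λ v p → refl) , λ w' w'≈ → subst (ℕ._≤ length w') (length-insert P g S) (red w' w'≈))

  reduced-no-descent : ∀ P g S → Reduced (P ++ g ∷ S) → ¬ (simple-height g (act R n S l) ℤ.< + 0)
  reduced-no-descent P g S red neg with exchange l dom S (αi g) (αj g) (αs g) (simple-positive g) neg
  ... | P₂ , g₂ , S₂ , refl , shortened = ℕP.<⇒≱ shorter (red (P ++ (P₂ ++ S₂)) same)
    where
    same : Same R n (P ++ (P₂ ++ S₂)) (P ++ g ∷ (P₂ ++ g₂ ∷ S₂))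
    same v p = trans (act-++ P (P₂ ++ S₂) v p)
      (trans (act-cong P (λ q → trans (shortened v q) (gen-is-reflection g _ q)) p)
             (sym (act-++ P (g ∷ (P₂ ++ g₂ ∷ S₂)) v p)))
    shorter : length (P ++ (P₂ ++ S₂)) ℕ.< length (P ++ g ∷ (P₂ ++ g₂ ∷ S₂))
    shorter rewrite length-insert P g (P₂ ++ g₂ ∷ S₂) | LP.length-++ P {P₂ ++ g₂ ∷ S₂}
                  | length-insert P₂ g₂ S₂ | LP.length-++ P {P₂ ++ S₂} =
      s≤s (ℕP.+-monoʳ-≤ (length P) (ℕP.n≤1+n (length (P₂ ++ S₂))))

  delete-fixing : ∀ ν P g S → simple-height g (act R n S l) ≡ + 0 → Rep ν (P ++ g ∷ S) → Rep ν (P ++ S)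
  delete-fixing ν P g S h0 rep p =
    trans (act-++ P S l p) (trans (act-cong P fixes p) (trans (sym (act-++ P (g ∷ S) l p)) (rep p)))
    where
    fixes : ∀ q → act R n S l q ≡ gen R n g (act R n S l) q
    fixes q = sym (trans (sym (gen-is-reflection g (act R n S l) q))
                         (affRefl-fixes (αi g) (αj g) (αs g) (act R n S l) q h0))

  MinimalBelow : V → Word R → Set
  MinimalBelow ν c = Σ (Word R) λ a → MinRep R n l ν a × Σ (Word R) λ c' → Same R n c' c × Star (BruhatStep R n) a c'

  -- Every word c for ν lies above a minimal word for ν: reduce c; if it is
  -- ascending it is minimal, otherwise delete a letter fixing the vector and recurse.
  minimal-below : ∀ fuel ν c → length c ℕ.≤ fuel → Rep ν c → MinimalBelow ν c
  minimal-below zero ν [] _ rep = [] , (rep , λ _ _ → z≤n) , [] , (λ v p → refl) , ε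
  minimal-below (suc fuel) ν c len rep with reduce c
  ... | c* , c*≈c , len* , red with ascending-or-descent l c*
  ...   | inj₁ asc = c* , (rep* , λ y ry → ascending-minimal l dom c* asc y (λ p → trans (ry p) (sym (rep* p)))) ,
                     c* , c*≈c , ε
    where
    rep* : Rep ν c*
    rep* p = trans (c*≈c l p) (rep p)
  ...   | inj₂ (P , g , S , refl , h≤0)
    with minimal-below fuel ν (P ++ S) len' (delete-fixing ν P g S h0 (λ p → trans (c*≈c l p) (rep p)))
    where
    h0 : simple-height g (act R n S l) ≡ + 0
    h0 = ℤP.≤-antisym h≤0 (ℤP.≮⇒≥ (reduced-no-descent P g S red))
    len' : length (P ++ S) ℕ.≤ fuel
    len' = ℕP.≤-pred (subst (ℕ._≤ suc fuel) (length-insert P g S) (ℕP.≤-trans len* len))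
  ... | a , minRep , c' , c'≈ , chain =
    a , minRep , P ++ g ∷ S , c*≈c ,
    chain ◅◅ (step-resp (P ++ S) c' (P ++ g ∷ S) c'≈ (delete-step P g S red) ◅ ε)

  lowering : ∀ μ c → Rep μ c → ∀ i j s → PosAffRoot i j s → height i j s μ ℤ.< + 0 →
    Σ (Word R) λ a → Σ (Word R) λ b →
      MinRep R n l (affRefl n i j s μ) a × MinRep R n l μ b × BruhatLe R n a b
  lowering μ c rep i j s pos neg with shortest (Rep μ) (rep? μ) c rep
  ... | b , rep-b , minimal-b
    with exchange l dom b i j s pos (subst (ℤ._< + 0) (sym (height-cong i j s rep-b)) neg)
  ...   | P , g , S , refl , shortened
    with minimal-below (length (P ++ S)) (affRefl n i j s μ) (P ++ S) ℕP.≤-refl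
           (λ p → trans (shortened l p) (affRefl-cong i j s rep-b p))
  ...     | a , minRep-a , c' , c'≈ , chain =
    a , P ++ g ∷ S , minRep-a , minRep-b ,
    (P ++ g ∷ S , (λ v p → refl) , chain ◅◅ (step-resp (P ++ S) c' (P ++ g ∷ S) c'≈ (delete-step P g S red) ◅ ε))
    where
    minRep-b : MinRep R n l μ (P ++ g ∷ S)
    minRep-b = rep-b , minimal-b
    red : Reduced (P ++ g ∷ S)
    red = minRep-reduced {μ} {P ++ g ∷ S} minRep-b

module Alcove (r' n : ℕ) where

  open Generators r' n
  open AffineRoots r' n
  open PositiveRoots r' n
  open Words r' n

  inA⇒dominant : ∀ l → InA R n l → Dominant l
  inA⇒dominant l (mono , width) i j s (ne , inj₁ (i<j , s≥0)) =
    ℤP.+-mono-≤ {+ 0} {l i - l j} {+ 0} {s * + n}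
      (ℤP.i≤j⇒0≤j-i (mono i j (ℕP.<⇒≤ i<j))) (ℤP.*-monoʳ-≤-nonNeg (+ n) s≥0)
  inA⇒dominant l (mono , width) i j s (ne , inj₂ s>0) =
    ℤP.≤-trans width≥0 (ℤP.+-mono-≤ spread n≤sn)
    where
    -- 0 ≤ (λ_r − λ_1) + n  ≤  (λ_i − λ_j) + sn
    width≥0 : + 0 ℤ.≤ (l lastR - l F.zero) + + n
    width≥0 = subst (+ 0 ℤ.≤_) (lem (l F.zero) (l lastR) (+ n))
                (ℤP.i≤j⇒0≤j-i (subst (λ z → l F.zero - z ℤ.≤ + n) (atℕ-last l) width))
      where
      lem : ∀ a b m → m - (a - b) ≡ (b - a) + m
      lem = solve-∀
    spread : l lastR - l F.zero ℤ.≤ l i - l j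
    spread = ℤP.+-mono-≤ (mono i lastR (subst (toℕ i ℕ.≤_) (sym toℕ-last) (toℕ≤last i)))
                         (ℤP.neg-mono-≤ (mono F.zero j z≤n))
    n≤sn : + n ℤ.≤ s * + n
    n≤sn = subst (ℤ._≤ s * + n) (ℤP.*-identityˡ (+ n)) (ℤP.*-monoʳ-≤-nonNeg (+ n) (ℤP.i<j⇒suc[i]≤j s>0))

  adjacent : ∀ v → (∀ g → + 0 ℤ.≤ simple-height g v) → ∀ m → suc m ℕ.< R → atℕ v (suc m) ℤ.≤ atℕ v m
  adjacent v h m lt = subst₂ ℤ._≤_ (sym at-suc) (sym at-m)
                        (ℤP.0≤i-j⇒j≤i (subst (+ 0 ℤ.≤_) (ℤP.+-identityʳ _) (h (F.suc g))))
    where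
    g : Fin (suc r')
    g = F.fromℕ< (ℕP.≤-pred lt)
    toℕ-g : toℕ g ≡ m
    toℕ-g = FP.toℕ-fromℕ< (ℕP.≤-pred lt)
    at-suc : atℕ v (suc m) ≡ v (F.suc g)
    at-suc = trans (cong (λ z → atℕ v (suc z)) (sym toℕ-g)) (atℕ-toℕ v (F.suc g))
    at-m : atℕ v m ≡ v (inject₁ g)
    at-m = trans (cong (atℕ v) (sym (trans (FP.toℕ-inject₁ g) toℕ-g))) (atℕ-toℕ v (inject₁ g))

  decreasing : ∀ v → (∀ g → + 0 ℤ.≤ simple-height g v) → ∀ a b → a ℕ.≤ b → b ℕ.< R → atℕ v b ℤ.≤ atℕ v a
  decreasing v h zero zero a≤b b<R = ℤP.≤-refl
  decreasing v h a (suc b) a≤b b<R with ℕP.m≤n⇒m<n∨m≡n a≤b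
  ... | inj₂ refl = ℤP.≤-refl
  ... | inj₁ a<1+b = ℤP.≤-trans (adjacent v h b b<R) (decreasing v h a b (ℕP.≤-pred a<1+b) (ℕP.<-trans (ℕP.n<1+n b) b<R))

  -- Together with h_{α_0}(v) ≥ 0, i.e. v_1 − v_r ≤ n, this is membership in A^(n).
  simple-nonneg⇒inA : ∀ v → (∀ g → + 0 ℤ.≤ simple-height g v) → InA R n v
  simple-nonneg⇒inA v h =
    (λ p q le → subst₂ ℤ._≤_ (atℕ-toℕ v q) (atℕ-toℕ v p) (decreasing v h (toℕ p) (toℕ q) le (FP.toℕ<n q))) ,
    subst (λ z → v F.zero - z ℤ.≤ + n) (sym (atℕ-last v))
      (ℤP.i-j≤0⇒i≤j (subst (ℤ._≤ + 0) (lem (v F.zero) (v lastR) (+ n)) (ℤP.neg-mono-≤ (h F.zero))))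
    where
    lem : ∀ a b m → - ((b - a) + + 1 * m) ≡ (a - b) - m
    lem = solve-∀

-- Every v ∈ ℤ^r is c λ for some λ ∈ A^(n) and word c: while some simple root
-- has negative height at v, apply its reflection; this strictly lowers the
-- nonnegative energy  E(v) = Σ_p (R v_p² + p v_p), so the descent stops, at a
-- vector with all simple heights nonnegative, i.e. in A^(n).
module Energy (r' n : ℕ) (n≥1 : 1 ℕ.≤ n) where

  open Generators r' n
  open AffineRoots r' n
  open Alcove r' n

  sumV : ∀ {m} → (Fin m → ℤ) → ℤ
  sumV {zero} f = + 0
  sumV {suc m} f = f F.zero + sumV (λ p → f (F.suc p))

  sum-cong : ∀ {m} (f g : Fin m → ℤ) → (∀ p → f p ≡ g p) → sumV f ≡ sumV g
  sum-cong {zero} f g eq = refl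
  sum-cong {suc m} f g eq = cong₂ _+_ (eq F.zero) (sum-cong _ _ (λ p → eq (F.suc p)))

  sum-nonneg : ∀ {m} (f : Fin m → ℤ) → (∀ p → + 0 ℤ.≤ f p) → + 0 ℤ.≤ sumV f
  sum-nonneg {zero} f h = ℤP.≤-refl
  sum-nonneg {suc m} f h = ℤP.+-mono-≤ (h F.zero) (sum-nonneg _ (λ p → h (F.suc p)))

  sum-update : ∀ {m} (f g : Fin m → ℤ) a → (∀ p → p ≢ a → f p ≡ g p) → sumV f ≡ sumV g + (f a - g a)
  sum-update {suc m} f g F.zero h
    rewrite sum-cong (λ p → f (F.suc p)) (λ p → g (F.suc p)) (λ p → h (F.suc p) (λ ())) =
    lem (f F.zero) (g F.zero) (sumV (λ p → g (F.suc p)))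
    where
    lem : ∀ a b c → a + c ≡ (b + c) + (a - b)
    lem = solve-∀
  sum-update {suc m} f g (F.suc a) h
    rewrite h F.zero (λ ())
          | sum-update (λ p → f (F.suc p)) (λ p → g (F.suc p)) a (λ p ne → h (F.suc p) (λ eq → ne (FP.suc-injective eq))) =
    sym (ℤP.+-assoc (g F.zero) (sumV (λ p → g (F.suc p))) (f (F.suc a) - g (F.suc a)))

  -- Changing two summands, via the intermediate function that agrees with f at a
  -- and with g elsewhere.
  sum-update₂ : ∀ {m} (f g : Fin m → ℤ) a b → a ≢ b → (∀ p → p ≢ a → p ≢ b → f p ≡ g p) →
    sumV f ≡ sumV g + ((f a - g a) + (f b - g b))
  sum-update₂ f g a b a≢b h = begin
    sumV f                                   ≡⟨ sum-update f k b f≈k ⟩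
    sumV k + (f b - k b)                     ≡⟨ cong₂ (λ x y → x + (f b - y)) (sum-update k g a k≈g) k-at-b ⟩
    (sumV g + (k a - g a)) + (f b - g b)     ≡⟨ cong (λ z → (sumV g + (z - g a)) + (f b - g b)) k-at-a ⟩
    (sumV g + (f a - g a)) + (f b - g b)     ≡⟨ ℤP.+-assoc (sumV g) _ _ ⟩
    sumV g + ((f a - g a) + (f b - g b))     ∎
    where
    open ≡-Reasoning
    k : _ → ℤ
    k p = if does (p F.≟ a) then f p else g p
    k-at-a : k a ≡ f a
    k-at-a with a F.≟ a
    ... | yes _ = refl
    ... | no a≢a = ⊥-elim (a≢a refl)
    k-at-b : k b ≡ g b
    k-at-b with b F.≟ a
    ... | yes b≡a = ⊥-elim (a≢b (sym b≡a))
    ... | no _ = refl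
    f≈k : ∀ p → p ≢ b → f p ≡ k p
    f≈k p p≢b with p F.≟ a
    ... | yes _ = refl
    ... | no p≢a = h p p≢a p≢b
    k≈g : ∀ p → p ≢ a → k p ≡ g p
    k≈g p p≢a with p F.≟ a
    ... | yes p≡a = ⊥-elim (p≢a p≡a)
    ... | no _ = refl

  term : Fin R → V → ℤ
  term p v = + R * (v p * v p) + + toℕ p * v p

  energy : V → ℤ
  energy v = sumV (λ p → term p v)

  term-nonneg : ∀ k x → k ℕ.≤ R → + 0 ℤ.≤ + R * (x * x) + + k * x
  term-nonneg k (+ m) _ = subst (+ 0 ℤ.≤_) (sym as-ℕ) (+≤+ z≤n)
    where
    as-ℕ : + R * (+ m * + m) + + k * + m ≡ + (R ℕ.* (m ℕ.* m) ℕ.+ k ℕ.* m)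
    as-ℕ = trans (cong₂ _+_ (trans (cong (+ R *_) (sym (ℤP.pos-* m m))) (sym (ℤP.pos-* R (m ℕ.* m))))
                            (sym (ℤP.pos-* k m)))
                 (sym (ℤP.pos-+ (R ℕ.* (m ℕ.* m)) (k ℕ.* m)))
  term-nonneg k -[1+ m ] k≤R =
    subst (+ 0 ℤ.≤_) (sym as-ℕ) (ℤP.i≤j⇒0≤j-i (+≤+ (ℕP.*-mono-≤ k≤R (ℕP.m≤m*n (suc m) (suc m)))))
    where
    lem : ∀ r k x → r * ((- x) * (- x)) + k * (- x) ≡ r * (x * x) - k * x
    lem = solve-∀
    as-ℕ : + R * (-[1+ m ] * -[1+ m ]) + + k * -[1+ m ] ≡ + (R ℕ.* (suc m ℕ.* suc m)) - + (k ℕ.* suc m)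
    as-ℕ = trans (lem (+ R) (+ k) (+ suc m))
                 (cong₂ _-_ (trans (cong (+ R *_) (sym (ℤP.pos-* (suc m) (suc m)))) (sym (ℤP.pos-* R (suc m ℕ.* suc m))))
                            (sym (ℤP.pos-* k (suc m))))

  energy-nonneg : ∀ v → + 0 ℤ.≤ energy v
  energy-nonneg v = sum-nonneg _ (λ p → term-nonneg (toℕ p) (v p) (ℕP.<⇒≤ (FP.toℕ<n p)))

  term-cong : ∀ p {v w : V} → v p ≡ w p → term p v ≡ term p w
  term-cong p eq rewrite eq = refl

  energy-change : ∀ (v w : V) a b → a ≢ b → (∀ p → p ≢ a → p ≢ b → w p ≡ v p) →
    energy w ≡ energy v + ((term a w - term a v) + (term b w - term b v))
  energy-change v w a b a≢b same =
    sum-update₂ (λ p → term p w) (λ p → term p v) a b a≢b (λ p na nb → term-cong p {w} {v} (same p na nb))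

  energy-gen-suc : ∀ g v → energy (gen R n (F.suc g) v) ≡ energy v + simple-height (F.suc g) v
  energy-gen-suc g v = trans (energy-change v w a b (inject₁≢suc g) unchanged) (cong (λ d → energy v + d) Δ)
    where
    w = gen R n (F.suc g) v
    a b : Fin R
    a = inject₁ g
    b = F.suc g
    unchanged : ∀ p → p ≢ a → p ≢ b → w p ≡ v p
    unchanged p na nb = trans (gen-shape (F.suc g) v p)
      (trans (cong (λ z → v z + + n * + 0)
                   (τS-other {g} {p} (λ eq → na (FP.toℕ-injective (trans eq (sym (FP.toℕ-inject₁ g)))))
                                      (λ eq → nb (FP.toℕ-injective eq))))
             (sym (plus0 (v p))))
    w-at-a : w a ≡ v b
    w-at-a rewrite gen-shape (F.suc g) v a | τS-left g = sym (plus0 _)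
    w-at-b : w b ≡ v a
    w-at-b rewrite gen-shape (F.suc g) v b | τS-right g = sym (plus0 _)
    lem : ∀ r k x y m → ((r * (y * y) + k * y) - (r * (x * x) + k * x))
                          + ((r * (x * x) + (+ 1 + k) * x) - (r * (y * y) + (+ 1 + k) * y))
                        ≡ (x - y) + + 0 * m
    lem = solve-∀
    Δ : (term a w - term a v) + (term b w - term b v) ≡ simple-height (F.suc g) v
    Δ rewrite term-cong a {w} {λ _ → v b} w-at-a | term-cong b {w} {λ _ → v a} w-at-b | FP.toℕ-inject₁ g =
      lem (+ R) (+ toℕ g) (v a) (v b) (+ n)

  energy-gen-zero : ∀ v → energy (gen R n F.zero v) ≡ energy v + simple-height F.zero v * (+ 2 * + n * + R - + suc r')
  energy-gen-zero v = trans (energy-change v w F.zero lastR (λ eq → last≢zero (sym eq)) unchanged) (cong (λ d → energy v + d) Δ)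
    where
    w = gen R n F.zero v
    unchanged : ∀ p → p ≢ F.zero → p ≢ lastR → w p ≡ v p
    unchanged p na nb = trans (gen-shape F.zero v p)
      (trans (cong₂ (λ z y → v z + + n * y) (τ0-other h1 h2) (e0-other h1 h2)) (sym (plus0 (v p))))
      where
      h1 : toℕ p ≢ 0
      h1 eq = na (FP.toℕ-injective eq)
      h2 : toℕ p ≢ suc r'
      h2 eq = nb (FP.toℕ-injective (trans eq (sym toℕ-last)))
    w-at-last : w lastR ≡ v F.zero + + n * -1ℤ
    w-at-last rewrite gen-shape F.zero v lastR | τ0-last | e0-last = refl
    lem : ∀ r k x y m → ((r * ((y + m * + 1) * (y + m * + 1)) + + 0 * (y + m * + 1)) - (r * (x * x) + + 0 * x))
                          + ((r * ((x + m * -1ℤ) * (x + m * -1ℤ)) + k * (x + m * -1ℤ)) - (r * (y * y) + k * y))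
                        ≡ ((y - x) + + 1 * m) * (+ 2 * m * r - k)
    lem = solve-∀
    Δ : (term F.zero w - term F.zero v) + (term lastR w - term lastR v) ≡ simple-height F.zero v * (+ 2 * + n * + R - + suc r')
    Δ rewrite term-cong F.zero {w} {λ _ → v lastR + + n * + 1} (gen-shape F.zero v F.zero)
            | term-cong lastR {w} {λ _ → v F.zero + + n * -1ℤ} w-at-last | FP.toℕ-fromℕ r' =
      lem (+ R) (+ suc r') (v F.zero) (v lastR) (+ n)

  factor-pos : + 0 ℤ.< + 2 * + n * + R - + suc r'
  factor-pos = subst (+ 0 ℤ.<_) (cong (_- + suc r') (trans (ℤP.pos-* (2 ℕ.* n) R) (cong (_* + R) (ℤP.pos-* 2 n))))
                 (subst (ℤ._< + (2 ℕ.* n ℕ.* R) - + suc r') (ℤP.+-inverseʳ (+ suc r'))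
                        (ℤP.+-monoˡ-< (- + suc r') (+<+ r<2nR)))
    where
    r<2nR : suc r' ℕ.< 2 ℕ.* n ℕ.* R
    r<2nR = ℕP.<-≤-trans (ℕP.n<1+n (suc r'))
              (subst (ℕ._≤ 2 ℕ.* n ℕ.* R) (ℕP.*-identityˡ R) (ℕP.*-monoˡ-≤ R (ℕP.*-mono-≤ {1} {2} {1} {n} (s≤s z≤n) n≥1)))

  add-negative : ∀ a {d} → d ℤ.< + 0 → a + d ℤ.< a
  add-negative a {d} h = subst (a + d ℤ.<_) (ℤP.+-identityʳ a) (ℤP.+-monoʳ-< a h)

  energy-decreases : ∀ g v → simple-height g v ℤ.< + 0 → energy (gen R n g v) ℤ.< energy v
  energy-decreases (F.suc g) v neg rewrite energy-gen-suc g v = add-negative (energy v) neg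
  energy-decreases F.zero v neg rewrite energy-gen-zero v =
    add-negative (energy v) (subst (simple-height F.zero v * c ℤ.<_) (ℤP.*-zeroˡ c) (ℤP.*-monoʳ-<-pos c {{ℤ.positive factor-pos}} neg))
    where
    c = + 2 * + n * + R - + suc r'

  nonneg-∣<∣ : ∀ {a b} → + 0 ℤ.≤ a → a ℤ.< b → ℤ.∣ a ∣ ℕ.< ℤ.∣ b ∣
  nonneg-∣<∣ {+ x} {+ y} _ lt = ℤP.drop‿+<+ lt
  nonneg-∣<∣ {+ x} { -[1+ y ]} _ ()

  to-alcove : ∀ bound v → ℤ.∣ energy v ∣ ℕ.≤ bound →
    Σ V λ l → InA R n l × Σ (Word R) λ c → ∀ p → act R n c l p ≡ v p
  to-alcove bound v E≤bound with FP.any? (λ g → simple-height g v ℤ.<? + 0)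
  ... | no none = v , simple-nonneg⇒inA v (λ g → ℤP.≮⇒≥ (λ lt → none (g , lt))) , [] , λ p → refl
  ... | yes (g , neg)
    with bound | ℕP.<-≤-trans (nonneg-∣<∣ (energy-nonneg (gen R n g v)) (energy-decreases g v neg)) E≤bound
  ...   | suc bound' | lt with to-alcove bound' (gen R n g v) (ℕP.≤-pred lt)
  ...     | l , inA , c , c-sends = l , inA , g ∷ c , λ p → trans (gen-cong g c-sends p) (gen-involutive g v p)

module Main (r' n : ℕ) (n≥1 : 1 ℕ.≤ n) where

  open Generators r' n
  open AffineRoots r' n
  open Words r' n
  open Alcove r' n
  open Energy r' n n≥1

  shorter-trans : ∀ {u v w} → Shorter R n u v → Shorter R n v w → Shorter R n u w
  shorter-trans (u' , u'≈u , u'<) (v' , v'≈v , v'<) =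
    u' , u'≈u , λ w' w'≈w → ℕP.<-trans (u'< v' v'≈v) (v'< w' w'≈w)

  chain-shorter : ∀ {u w} → Star (BruhatStep R n) u w → u ≡ w ⊎ Shorter R n u w
  chain-shorter ε = inj₁ refl
  chain-shorter {u} {w} (_◅_ {j = v} (_ , _ , _ , shorter) chain) with chain-shorter chain
  ... | inj₁ refl = inj₂ shorter
  ... | inj₂ shorter' = inj₂ (shorter-trans {u} {v} {w} shorter shorter')

  bruhat-shorter : ∀ u w → BruhatLe R n u w → Same R n u w ⊎ Shorter R n u w
  bruhat-shorter u w (w' , w'≈w , chain) with chain-shorter chain
  ... | inj₁ refl = inj₁ w'≈w
  ... | inj₂ (u' , u'≈u , u'<) = inj₂ (u' , u'≈u , λ w'' w''≈w → u'< w'' (λ v p → trans (w''≈w v p) (sym (w'≈w v p))))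

  minimal-bruhat-shorter : ∀ l ν μ a b → MinRep R n l ν a → MinRep R n l μ b → BruhatLe R n a b →
    (∀ p → ν p ≡ μ p) ⊎ (length a ℕ.< length b)
  minimal-bruhat-shorter l ν μ a b (rep-a , min-a) (rep-b , _) a≤b with bruhat-shorter a b a≤b
  ... | inj₁ a≈b = inj₁ (λ p → trans (sym (rep-a p)) (trans (a≈b l p) (rep-b p)))
  ... | inj₂ (a' , a'≈a , a'<) = inj₂ (ℕP.≤-<-trans (min-a a' (λ p → trans (a'≈a l p) (rep-a p))) (a'< b (λ v p → refl)))

  pairing-height : ∀ i j s μ → pairing n i j s μ ≡ + n * height i j s μ
  pairing-height i j s μ = lem (μ i) (μ j) s (+ n)
    where
    lem : ∀ a b s m → m * (a - b) + s * (m * m) ≡ m * ((a - b) + s * m)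
    lem = solve-∀

  height-neg⇒pairing-neg : ∀ i j s μ → height i j s μ < + 0 → pairing n i j s μ < + 0
  height-neg⇒pairing-neg i j s μ neg rewrite pairing-height i j s μ =
    subst (+ n * height i j s μ <_) (ℤP.*-zeroʳ (+ n)) (ℤP.*-monoˡ-<-pos (+ n) {{ℤ.positive (+<+ n≥1)}} neg)

  pairing-neg⇒height-neg : ∀ i j s μ → pairing n i j s μ < + 0 → height i j s μ < + 0
  pairing-neg⇒height-neg i j s μ neg = ℤP.≰⇒> λ h≥0 → ℤP.<⇒≱ neg (subst (+ 0 ℤ.≤_) (sym (pairing-height i j s μ))
    (subst (ℤ._≤ + n * height i j s μ) (ℤP.*-zeroʳ (+ n)) (ℤP.*-monoˡ-≤-nonNeg (+ n) h≥0)))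

  lowering-LtN : ∀ μ i j s → PosAffRoot i j s → height i j s μ < + 0 → LtN R n (affRefl n i j s μ) μ
  lowering-LtN μ i j s pos neg with to-alcove ℤ.∣ energy μ ∣ μ ℕP.≤-refl
  ... | l , inA , c , c-sends with Lowering.lowering r' n n≥1 l (inA⇒dominant l inA) μ c c-sends i j s pos neg
  ...   | a , b , min-a , min-b , a≤b =
    (l , inA , a , b , min-a , min-b , a≤b) ,
    λ fixed → ℤP.<-irrefl (affRefl-moves i j s μ (proj₁ pos) fixed) neg

  -- (⇒) If s_α μ <ⁿ μ then h_α(μ) < 0: height 0 means s_α fixes μ, and height
  -- > 0 would also give μ = s_α(s_α μ) <ⁿ s_α μ over the same λ, so the minimal
  -- word of each would be strictly shorter than the other's.
  LtN⇒height-neg : ∀ μ i j s → PosAffRoot i j s → LtN R n (affRefl n i j s μ) μ → height i j s μ < + 0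
  LtN⇒height-neg μ i j s pos ((l , inA , a , b , min-a , min-b , a≤b) , moved) with ℤP.<-cmp (height i j s μ) (+ 0)
  ... | tri< neg _ _ = neg
  ... | tri≈ _ h0 _ = ⊥-elim (moved (λ p → affRefl-fixes i j s μ p h0))
  ... | tri> _ _ pos-h
    with Lowering.lowering r' n n≥1 l (inA⇒dominant l inA) (affRefl n i j s μ) a (proj₁ min-a) i j s pos
           (subst (_< + 0) (sym (height-affRefl i j s μ ne)) (ℤP.neg-mono-< pos-h))
    where ne = proj₁ pos
  ...   | a' , b' , min-a' , min-b' , a'≤b'
    with minimal-bruhat-shorter l _ _ a b min-a min-b a≤b | minimal-bruhat-shorter l _ _ a' b' min-a' min-b' a'≤b'
  ...     | inj₁ same | _ = ⊥-elim (moved same)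
  ...     | inj₂ _ | inj₁ same = ⊥-elim (moved (λ p → sym (trans (sym (affRefl-involutive i j s μ p (proj₁ pos))) (same p))))
  ...     | inj₂ a<b | inj₂ a'<b' = ⊥-elim (ℕP.<-irrefl refl (ℕP.<-trans (ℕP.<-≤-trans a<b b≤a') (ℕP.<-≤-trans a'<b' b'≤a)))
    where
    b≤a' : length b ℕ.≤ length a'
    b≤a' = proj₂ min-b a' (λ p → trans (proj₁ min-a' p) (affRefl-involutive i j s μ p (proj₁ pos)))
    b'≤a : length b' ℕ.≤ length a
    b'≤a = proj₂ min-b' a (proj₁ min-a)

  theorem : (μ : Fin R → ℤ) → (i j : Fin R) → (s : ℤ) → PosAffRoot i j s →
    (LtN R n (affRefl n i j s μ) μ ⇔ (pairing n i j s μ < + 0))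
  theorem μ i j s pos =
    mk⇔ (λ lt → height-neg⇒pairing-neg i j s μ (LtN⇒height-neg μ i j s pos lt))
        (λ neg → lowering-LtN μ i j s pos (pairing-neg⇒height-neg i j s μ neg))

lemma3p12 : (r n : ℕ) → 2 ≤ r → 1 ≤ n → (μ : Fin r → ℤ) → (i j : Fin r) → (s : ℤ) →
    PosAffRoot i j s →
    (LtN r n (affRefl n i j s μ) μ ⇔ (pairing n i j s μ < + 0))
lemma3p12 (suc (suc r')) n _ n≥1 = Main.theorem r' n n≥1
lemma3p12 (suc zero) n (s≤s ()) _
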